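{- If $\phi$ is a formula disjunctive in $x$, then $\mu_{x}.\phi(x) = \phi^{n +1}(\bot)$ (in every Heyting algebra under every valuation), where $n$ is the cardinality of the set $\mathsf{Head}(\phi)$.
   Context: Formulas are IPC formulas built with $\top,\bot,\land,\vee,\to$, interpreted in Heyting algebras. A formula is disjunctive in $x$ if it is generated by the grammar $\phi ::= x \mid \alpha \to \phi \mid \beta \vee \phi \mid \phi \vee \phi$, where $\alpha$ and $\beta$ do not contain $x$; $\mathsf{Head}(\phi)$ is the set of formulas $\alpha$ appearing in the production $\alpha \to \phi$ in a parse of $\phi$ (head subformulas). $\phi^{k}(\bot)$ is the $k$-fold iterate of the induced monotone function applied to $\bot$, and $\mu_{x}.\phi$ its least fixed point. -}

module Defs where

open import Level using (Level)
open import Data.Nat using (ℕ; suc)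
import Data.Nat.Properties as ℕP
open import Data.List using (List; []; _∷_; _++_; length; deduplicate)
open import Data.Product using (_×_)
open import Relation.Nullary using (¬_; Dec; yes; no)
open import Relation.Binary.PropositionalEquality using (_≡_; refl; cong)
open import Relation.Binary.Definitions using (DecidableEquality)
open import Relation.Binary.Lattice.Bundles using (HeytingAlgebra)
open import Function using (id)

data Formula : Set where
  var  : ℕ → Formula
  ⊤ᶠ   : Formula
  ⊥ᶠ   : Formula
  _∧ᶠ_ : Formula → Formula → Formula
  _∨ᶠ_ : Formula → Formula → Formula
  _⇒ᶠ_ : Formula → Formula → Formula

_≟ᶠ_ : DecidableEquality Formula
var m ≟ᶠ var n with m ℕP.≟ n
... | yes refl = yes refl
... | no m≢n = no λ { refl → m≢n refl }
var _ ≟ᶠ ⊤ᶠ = no λ ()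
var _ ≟ᶠ ⊥ᶠ = no λ ()
var _ ≟ᶠ (_ ∧ᶠ _) = no λ ()
var _ ≟ᶠ (_ ∨ᶠ _) = no λ ()
var _ ≟ᶠ (_ ⇒ᶠ _) = no λ ()
⊤ᶠ ≟ᶠ var _ = no λ ()
⊤ᶠ ≟ᶠ ⊤ᶠ = yes refl
⊤ᶠ ≟ᶠ ⊥ᶠ = no λ ()
⊤ᶠ ≟ᶠ (_ ∧ᶠ _) = no λ ()
⊤ᶠ ≟ᶠ (_ ∨ᶠ _) = no λ ()
⊤ᶠ ≟ᶠ (_ ⇒ᶠ _) = no λ ()
⊥ᶠ ≟ᶠ var _ = no λ ()
⊥ᶠ ≟ᶠ ⊤ᶠ = no λ ()
⊥ᶠ ≟ᶠ ⊥ᶠ = yes refl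
⊥ᶠ ≟ᶠ (_ ∧ᶠ _) = no λ ()
⊥ᶠ ≟ᶠ (_ ∨ᶠ _) = no λ ()
⊥ᶠ ≟ᶠ (_ ⇒ᶠ _) = no λ ()
(_ ∧ᶠ _) ≟ᶠ var _ = no λ ()
(_ ∧ᶠ _) ≟ᶠ ⊤ᶠ = no λ ()
(_ ∧ᶠ _) ≟ᶠ ⊥ᶠ = no λ ()
(a ∧ᶠ b) ≟ᶠ (c ∧ᶠ d) with a ≟ᶠ c | b ≟ᶠ d
... | yes refl | yes refl = yes refl
... | no p | _ = no λ { refl → p refl }
... | yes _ | no q = no λ { refl → q refl }
(_ ∧ᶠ _) ≟ᶠ (_ ∨ᶠ _) = no λ ()
(_ ∧ᶠ _) ≟ᶠ (_ ⇒ᶠ _) = no λ ()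
(_ ∨ᶠ _) ≟ᶠ var _ = no λ ()
(_ ∨ᶠ _) ≟ᶠ ⊤ᶠ = no λ ()
(_ ∨ᶠ _) ≟ᶠ ⊥ᶠ = no λ ()
(_ ∨ᶠ _) ≟ᶠ (_ ∧ᶠ _) = no λ ()
(a ∨ᶠ b) ≟ᶠ (c ∨ᶠ d) with a ≟ᶠ c | b ≟ᶠ d
... | yes refl | yes refl = yes refl
... | no p | _ = no λ { refl → p refl }
... | yes _ | no q = no λ { refl → q refl }
(_ ∨ᶠ _) ≟ᶠ (_ ⇒ᶠ _) = no λ ()
(_ ⇒ᶠ _) ≟ᶠ var _ = no λ ()
(_ ⇒ᶠ _) ≟ᶠ ⊤ᶠ = no λ ()
(_ ⇒ᶠ _) ≟ᶠ ⊥ᶠ = no λ ()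
(_ ⇒ᶠ _) ≟ᶠ (_ ∧ᶠ _) = no λ ()
(_ ⇒ᶠ _) ≟ᶠ (_ ∨ᶠ _) = no λ ()
(a ⇒ᶠ b) ≟ᶠ (c ⇒ᶠ d) with a ≟ᶠ c | b ≟ᶠ d
... | yes refl | yes refl = yes refl
... | no p | _ = no λ { refl → p refl }
... | yes _ | no q = no λ { refl → q refl }

data Occurs (x : ℕ) : Formula → Set where
  here : Occurs x (var x)
  ∧ˡ : ∀ {a b} → Occurs x a → Occurs x (a ∧ᶠ b)
  ∧ʳ : ∀ {a b} → Occurs x b → Occurs x (a ∧ᶠ b)
  ∨ˡ : ∀ {a b} → Occurs x a → Occurs x (a ∨ᶠ b)
  ∨ʳ : ∀ {a b} → Occurs x b → Occurs x (a ∨ᶠ b)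
  ⇒ˡ : ∀ {a b} → Occurs x a → Occurs x (a ⇒ᶠ b)
  ⇒ʳ : ∀ {a b} → Occurs x b → Occurs x (a ⇒ᶠ b)

-- φ is disjunctive in x:  φ ::= x | α → φ | β ∨ φ | φ ∨ φ  (α, β x-free).
-- An element of this type is a parse of φ according to the grammar.
data Disjunctive (x : ℕ) : Formula → Set where
  dvar : Disjunctive x (var x)
  dimp : ∀ {α φ} → ¬ Occurs x α → Disjunctive x φ → Disjunctive x (α ⇒ᶠ φ)
  dorβ : ∀ {β φ} → ¬ Occurs x β → Disjunctive x φ → Disjunctive x (β ∨ᶠ φ)
  dor  : ∀ {φ ψ} → Disjunctive x φ → Disjunctive x ψ → Disjunctive x (φ ∨ᶠ ψ)

headList : ∀ {x φ} → Disjunctive x φ → List Formula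
headList dvar = []
headList (dimp {α} _ d) = α ∷ headList d
headList (dorβ _ d) = headList d
headList (dor d e) = headList d ++ headList e

-- cardinality of the set Head(φ) (syntactically distinct head formulas)
∣Head∣ : ∀ {x φ} → Disjunctive x φ → ℕ
∣Head∣ d = length (deduplicate _≟ᶠ_ (headList d))

module _ {c ℓ₁ ℓ₂ : Level} (H : HeytingAlgebra c ℓ₁ ℓ₂) where
  open HeytingAlgebra H

  ⟦_⟧ : Formula → (ℕ → Carrier) → Carrier
  ⟦ var n ⟧ v = v n
  ⟦ ⊤ᶠ ⟧ v = ⊤
  ⟦ ⊥ᶠ ⟧ v = ⊥
  ⟦ a ∧ᶠ b ⟧ v = ⟦ a ⟧ v ∧ ⟦ b ⟧ v
  ⟦ a ∨ᶠ b ⟧ v = ⟦ a ⟧ v ∨ ⟦ b ⟧ v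
  ⟦ a ⇒ᶠ b ⟧ v = ⟦ a ⟧ v ⇨ ⟦ b ⟧ v

  update : (ℕ → Carrier) → ℕ → Carrier → ℕ → Carrier
  update v x a n with n ℕP.≟ x
  ... | yes _ = a
  ... | no _ = v n

  induced : Formula → ℕ → (ℕ → Carrier) → Carrier → Carrier
  induced φ x v a = ⟦ φ ⟧ (update v x a)

  iter : ℕ → (Carrier → Carrier) → Carrier → Carrier
  iter 0 f a = a
  iter (suc k) f a = f (iter k f a)

  IsLeastFixedPoint : (Carrier → Carrier) → Carrier → Set _
  IsLeastFixedPoint f a = (f a ≈ a) × (∀ b → f b ≈ b → a ≤ b)

module Submission where

-- Write f for the induced map and y k = f^k(⊥). Since f is monotone the y k increase, so a
-- stage with f (y k) ≤ y k is already the least fixed point. Because x never occurs under a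
-- conjunction or in a head, f is moreover strong: e ∧ f a ≤ f (e ∧ a). The central estimate:
-- if every head α either lies in a list R or satisfies c ≤ α, and c ∧ α ∧ a ≤ b for α ∈ R,
-- then c ∧ f a ≤ f b ∨ a. Heads entailed by c can be discharged, and under a head α ∈ R the
-- hypothesis lets us trade a for b. By induction on the length of R, moving each removed head
-- into the context c, this gives c ∧ y (m + 2) ≤ y (m + 1) whenever |R| ≤ m; with c = ⊤ and
-- R = Head(φ) it yields f (y (n + 1)) ≤ y (n + 1).

open import Defs
open import Level using (Level)
open import Data.Nat using (ℕ; zero; suc; _<_) renaming (_≤_ to _≤ℕ_)
import Data.Nat.Properties as ℕ
open import Data.List using (List; []; length; deduplicate; filter)
open import Data.List.Properties using (filter-notAll)
open import Data.List.Membership.Propositional using (_∈_)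
open import Data.List.Membership.Propositional.Properties
  using (∈-++⁺ˡ; ∈-++⁺ʳ; ∈-filter⁺; ∈-deduplicate⁺)
open import Data.List.Relation.Unary.Any using (here; there)
import Data.List.Relation.Unary.Any as Any
open import Data.Sum using (_⊎_; inj₁; inj₂)
open import Data.Product using (_,_)
open import Data.Empty using (⊥-elim)
open import Function using (_∘_)
open import Relation.Nullary using (¬_; yes; no; ¬?)
open import Relation.Binary.PropositionalEquality using (_≡_; refl; sym; cong₂)
open import Relation.Binary.Lattice.Bundles using (HeytingAlgebra)
import Relation.Binary.Lattice.Properties.HeytingAlgebra as HeytingAlgebraProperties
import Relation.Binary.Lattice.Properties.JoinSemilattice as JoinSemilatticeProperties
import Relation.Binary.Lattice.Properties.MeetSemilattice as MeetSemilatticeProperties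
import Relation.Binary.Reasoning.PartialOrder as ≤-Reasoning

delete : Formula → List Formula → List Formula
delete α = filter (λ β → ¬? (β ≟ᶠ α))

length-delete : ∀ {α R} → α ∈ R → length (delete α R) < length R
length-delete {α} α∈R = filter-notAll (λ β → ¬? (β ≟ᶠ α)) _ (Any.map (λ α≡β β≢α → β≢α (sym α≡β)) α∈R)

module _ {o ℓ₁ ℓ₂ : Level} (H : HeytingAlgebra o ℓ₁ ℓ₂) where
  open HeytingAlgebra H renaming (refl to ≤-refl)
  open HeytingAlgebraProperties H using (⇨-eval; ⇨-applyʳ; ⇨ʳ-covariant; y≤x⇨y; ∧-distribˡ-∨-≤)
  open JoinSemilatticeProperties joinSemilattice using (∨-monotonic; ∨-assoc)
  open MeetSemilatticeProperties meetSemilattice using (∧-monotonic)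
  open ≤-Reasoning poset

  ∧-⇨-eval : ∀ {w x y} → (w ∧ (x ⇨ y)) ∧ x ≤ (w ∧ x) ∧ y
  ∧-⇨-eval = ∧-greatest (∧-monotonic (x∧y≤x _ _) ≤-refl) (trans (∧-monotonic (x∧y≤y _ _) ≤-refl) ⇨-eval)

  iter-⊥-≤-step : ∀ {f} → (∀ {a b} → a ≤ b → f a ≤ f b) →
                  ∀ k → iter H k f ⊥ ≤ f (iter H k f ⊥)
  iter-⊥-≤-step mono zero    = minimum _
  iter-⊥-≤-step mono (suc k) = mono (iter-⊥-≤-step mono k)

  iter-⊥-≤-prefixedPoint : ∀ {f} → (∀ {a b} → a ≤ b → f a ≤ f b) →
                           ∀ {b} → f b ≤ b → ∀ k → iter H k f ⊥ ≤ b
  iter-⊥-≤-prefixedPoint mono fb≤b zero    = minimum _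
  iter-⊥-≤-prefixedPoint mono fb≤b (suc k) = trans (mono (iter-⊥-≤-prefixedPoint mono fb≤b k)) fb≤b

  iter-⊥-isLeastFixedPoint : ∀ {f} → (∀ {a b} → a ≤ b → f a ≤ f b) →
                             ∀ k → f (iter H k f ⊥) ≤ iter H k f ⊥ →
                             IsLeastFixedPoint H f (iter H k f ⊥)
  iter-⊥-isLeastFixedPoint mono k stable =
      antisym stable (iter-⊥-≤-step mono k)
    , λ b fb≈b → iter-⊥-≤-prefixedPoint mono (reflexive fb≈b) k

  module _ (v : ℕ → Carrier) (x : ℕ) where

    update-same : ∀ a → update H v x a x ≡ a
    update-same a with x ℕ.≟ x
    ... | yes _  = refl
    ... | no x≢x = ⊥-elim (x≢x refl)

    ⟦⟧-update-fresh : ∀ {α} → ¬ Occurs x α → ∀ a → ⟦ H ⟧ α (update H v x a) ≡ ⟦ H ⟧ α v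
    ⟦⟧-update-fresh {var n} x∉α a with n ℕ.≟ x
    ... | yes refl = ⊥-elim (x∉α here)
    ... | no _     = refl
    ⟦⟧-update-fresh {⊤ᶠ} x∉α a = refl
    ⟦⟧-update-fresh {⊥ᶠ} x∉α a = refl
    ⟦⟧-update-fresh {p ∧ᶠ q} x∉α a =
      cong₂ _∧_ (⟦⟧-update-fresh (x∉α ∘ ∧ˡ) a) (⟦⟧-update-fresh (x∉α ∘ ∧ʳ) a)
    ⟦⟧-update-fresh {p ∨ᶠ q} x∉α a =
      cong₂ _∨_ (⟦⟧-update-fresh (x∉α ∘ ∨ˡ) a) (⟦⟧-update-fresh (x∉α ∘ ∨ʳ) a)
    ⟦⟧-update-fresh {p ⇒ᶠ q} x∉α a =
      cong₂ _⇨_ (⟦⟧-update-fresh (x∉α ∘ ⇒ˡ) a) (⟦⟧-update-fresh (x∉α ∘ ⇒ʳ) a)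

    F : Formula → Carrier → Carrier
    F ψ = induced H ψ x v

    induced-monotone : ∀ {ψ} → Disjunctive x ψ → ∀ {a b} → a ≤ b → F ψ a ≤ F ψ b
    induced-monotone dvar {a} {b} a≤b rewrite update-same a | update-same b = a≤b
    induced-monotone (dimp x∉α d) {a} {b} a≤b
      rewrite ⟦⟧-update-fresh x∉α a | ⟦⟧-update-fresh x∉α b = ⇨ʳ-covariant (induced-monotone d a≤b)
    induced-monotone (dorβ x∉β d) {a} {b} a≤b
      rewrite ⟦⟧-update-fresh x∉β a | ⟦⟧-update-fresh x∉β b = ∨-monotonic ≤-refl (induced-monotone d a≤b)
    induced-monotone (dor d e) a≤b = ∨-monotonic (induced-monotone d a≤b) (induced-monotone e a≤b)

    induced-strong : ∀ {ψ} → Disjunctive x ψ → ∀ e a → e ∧ F ψ a ≤ F ψ (e ∧ a)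
    induced-strong dvar e a rewrite update-same a | update-same (e ∧ a) = ≤-refl
    induced-strong (dimp {α} {ψ} x∉α d) e a
      rewrite ⟦⟧-update-fresh x∉α a | ⟦⟧-update-fresh x∉α (e ∧ a) = transpose-⇨ (begin
        (e ∧ (A ⇨ F ψ a)) ∧ A  ≤⟨ ∧-⇨-eval ⟩
        (e ∧ A) ∧ F ψ a        ≤⟨ ∧-monotonic (x∧y≤x _ _) ≤-refl ⟩
        e ∧ F ψ a              ≤⟨ induced-strong d e a ⟩
        F ψ (e ∧ a)            ∎)
      where A = ⟦ H ⟧ α v
    induced-strong (dorβ {β} {ψ} x∉β d) e a
      rewrite ⟦⟧-update-fresh x∉β a | ⟦⟧-update-fresh x∉β (e ∧ a) = begin
        e ∧ (B ∨ F ψ a)        ≤⟨ ∧-distribˡ-∨-≤ _ _ _ ⟩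
        e ∧ B ∨ e ∧ F ψ a      ≤⟨ ∨-monotonic (x∧y≤y _ _) (induced-strong d e a) ⟩
        B ∨ F ψ (e ∧ a)        ∎
      where B = ⟦ H ⟧ β v
    induced-strong (dor {ψ} {χ} d d′) e a = begin
      e ∧ (F ψ a ∨ F χ a)      ≤⟨ ∧-distribˡ-∨-≤ _ _ _ ⟩
      e ∧ F ψ a ∨ e ∧ F χ a    ≤⟨ ∨-monotonic (induced-strong d e a) (induced-strong d′ e a) ⟩
      F ψ (e ∧ a) ∨ F χ (e ∧ a) ∎

    HeadsCovered : List Formula → Carrier → ∀ {ψ} → Disjunctive x ψ → Set _
    HeadsCovered R c d = ∀ {α} → α ∈ headList d → α ∈ R ⊎ c ≤ ⟦ H ⟧ α v

    HeadsCovered-delete : ∀ {R c α ψ} {d : Disjunctive x ψ} →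
                          HeadsCovered R c d → HeadsCovered (delete α R) (c ∧ ⟦ H ⟧ α v) d
    HeadsCovered-delete {α = α} cov {β} β∈heads with cov β∈heads
    ... | inj₂ c≤B = inj₂ (trans (x∧y≤x _ _) c≤B)
    ... | inj₁ β∈R with β ≟ᶠ α
    ...   | yes refl = inj₂ (x∧y≤y _ _)
    ...   | no β≢α   = inj₁ (∈-filter⁺ (λ γ → ¬? (γ ≟ᶠ α)) β∈R β≢α)

    ∧-induced-≤-induced-∨ : ∀ {ψ} (d : Disjunctive x ψ) {R c a b} → HeadsCovered R c d →
                            (∀ {α} → α ∈ R → (c ∧ ⟦ H ⟧ α v) ∧ a ≤ b) →
                            c ∧ F ψ a ≤ F ψ b ∨ a
    ∧-induced-≤-induced-∨ dvar {c = c} {a} {b} cov hyp = begin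
      c ∧ F (var x) a   ≤⟨ x∧y≤y _ _ ⟩
      F (var x) a       ≡⟨ update-same a ⟩
      a                 ≤⟨ y≤x∨y _ _ ⟩
      F (var x) b ∨ a   ∎
    ∧-induced-≤-induced-∨ (dimp {α} {ψ} x∉α d) {c = c} {a} {b} cov hyp
      rewrite ⟦⟧-update-fresh x∉α a | ⟦⟧-update-fresh x∉α b with cov (here refl)
    ... | inj₂ c≤A = begin
      c ∧ (A ⇨ F ψ a)   ≤⟨ ∧-greatest (x∧y≤x _ _) (⇨-applyʳ c≤A) ⟩
      c ∧ F ψ a         ≤⟨ ∧-induced-≤-induced-∨ d (cov ∘ there) hyp ⟩
      F ψ b ∨ a         ≤⟨ ∨-monotonic y≤x⇨y ≤-refl ⟩
      (A ⇨ F ψ b) ∨ a   ∎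
      where A = ⟦ H ⟧ α v
    ... | inj₁ α∈R = trans (transpose-⇨ (begin
      (c ∧ (A ⇨ F ψ a)) ∧ A ≤⟨ ∧-⇨-eval ⟩
      (c ∧ A) ∧ F ψ a       ≤⟨ induced-strong d _ a ⟩
      F ψ ((c ∧ A) ∧ a)     ≤⟨ induced-monotone d (hyp α∈R) ⟩
      F ψ b                 ∎)) (x≤x∨y _ _)
      where A = ⟦ H ⟧ α v
    ∧-induced-≤-induced-∨ (dorβ {β} {ψ} x∉β d) {c = c} {a} {b} cov hyp
      rewrite ⟦⟧-update-fresh x∉β a | ⟦⟧-update-fresh x∉β b = begin
      c ∧ (B ∨ F ψ a)     ≤⟨ ∧-distribˡ-∨-≤ _ _ _ ⟩
      c ∧ B ∨ c ∧ F ψ a   ≤⟨ ∨-monotonic (x∧y≤y _ _) (∧-induced-≤-induced-∨ d cov hyp) ⟩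
      B ∨ (F ψ b ∨ a)     ≈⟨ ∨-assoc _ _ _ ⟨
      (B ∨ F ψ b) ∨ a     ∎
      where B = ⟦ H ⟧ β v
    ∧-induced-≤-induced-∨ (dor {ψ} {χ} d d′) {c = c} {a} {b} cov hyp = begin
      c ∧ (F ψ a ∨ F χ a)           ≤⟨ ∧-distribˡ-∨-≤ _ _ _ ⟩
      c ∧ F ψ a ∨ c ∧ F χ a         ≤⟨ ∨-monotonic (∧-induced-≤-induced-∨ d (cov ∘ ∈-++⁺ˡ) hyp)
                                                   (∧-induced-≤-induced-∨ d′ (cov ∘ ∈-++⁺ʳ _) hyp) ⟩
      (F ψ b ∨ a) ∨ (F χ b ∨ a)     ≤⟨ ∨-least (∨-monotonic (x≤x∨y _ _) ≤-refl)
                                               (∨-monotonic (y≤x∨y _ _) ≤-refl) ⟩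
      (F ψ b ∨ F χ b) ∨ a           ∎

    module _ {φ} (d : Disjunctive x φ) where

      ∧-iter-step : ∀ k {R c} → HeadsCovered R c d →
                    (∀ {α} → α ∈ R → (c ∧ ⟦ H ⟧ α v) ∧ iter H (suc k) (F φ) ⊥ ≤ iter H k (F φ) ⊥) →
                    c ∧ iter H (suc (suc k)) (F φ) ⊥ ≤ iter H (suc k) (F φ) ⊥
      ∧-iter-step k cov hyp = trans (∧-induced-≤-induced-∨ d cov hyp) (∨-least ≤-refl ≤-refl)

      ∧-iter-stable : ∀ m {R c} → length R ≤ℕ m → HeadsCovered R c d →
                      c ∧ iter H (suc (suc m)) (F φ) ⊥ ≤ iter H (suc m) (F φ) ⊥
      ∧-iter-stable zero    {[]} _        cov = ∧-iter-step zero cov λ ()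
      ∧-iter-stable (suc m)      |R|≤1+m cov = ∧-iter-step (suc m) cov λ α∈R →
        ∧-iter-stable m (ℕ.≤-pred (ℕ.≤-trans (length-delete α∈R) |R|≤1+m)) (HeadsCovered-delete {d = d} cov)

proposition6p12 : (x : ℕ) (φ : Formula) (d : Disjunctive x φ)
    {c ℓ₁ ℓ₂ : Level} (H : HeytingAlgebra c ℓ₁ ℓ₂) (v : ℕ → HeytingAlgebra.Carrier H) →
    IsLeastFixedPoint H (induced H φ x v)
    (iter H (suc (∣Head∣ d)) (induced H φ x v) (HeytingAlgebra.⊥ H))
proposition6p12 x φ d H v =
  iter-⊥-isLeastFixedPoint H (induced-monotone H v x d) (suc n)
    (trans (∧-greatest (maximum _) ≤-refl) (∧-iter-stable H v x d n ℕ.≤-refl everyHeadListed))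
  where
  open HeytingAlgebra H using (trans; ∧-greatest; maximum; ⊤) renaming (refl to ≤-refl)
  n = ∣Head∣ d
  everyHeadListed : HeadsCovered H v x (deduplicate _≟ᶠ_ (headList d)) ⊤ d
  everyHeadListed α∈heads = inj₁ (∈-deduplicate⁺ _≟ᶠ_ α∈heads)
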